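{- Let $p\geq1$, let $n_0,\dots,n_{p-1}>1$ be natural numbers, and let $t_0,\dots,t_{p-1}$ and $x$ be positive rational numbers. Let $n$ be the least common multiple of $n_0,\dots,n_{p-1}$, for $i\neq j$ let $d_{i,j}$ be the greatest common divisor of $n_i$ and $n_j$, let $c_0,\dots,c_{p-1}$ be integers with $\sum_{i<p}c_i(n/n_i)=1$, and let $\beta=\prod_{i<p}t_i^{c_i(n/n_i)}$. Then $$\bigwedge_{i<p}\Re_{n_i}(x\cdot t_i)\iff \Re_n(x\cdot\beta)\wedge\bigwedge_{i\neq j}\Re_{d_{i,j}}(t_i\cdot t_j^{ -1}).$$
   Context: For $m>1$ and $w\in\mathbb{Q}^+$, $\Re_m(w)$ means that there exists $y\in\mathbb{Q}^+$ with $w=y^m$; by convention $\Re_1(w)$ is always true (relevant if some $d_{i,j}=1$). -}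

module Defs where

open import Data.Nat as ℕ using (ℕ; zero; suc)
open import Data.Nat.DivMod using (_/_)
open import Data.Nat.LCM using (lcm)
open import Data.Integer as ℤ using (ℤ; +_; -[1+_])
open import Data.Rational as ℚ using (ℚ; 1ℚ; 1/_; NonZero; Positive; _*_)
open import Data.Fin using (Fin; zero; suc)
open import Data.Product using (∃-syntax; _×_)
open import Data.Unit using (⊤)
open import Relation.Binary.PropositionalEquality using (_≡_)

_^ℕ_ : ℚ → ℕ → ℚ
q ^ℕ zero  = 1ℚ
q ^ℕ suc k = q * (q ^ℕ k)

_^ℤ_ : (q : ℚ) → .{{NonZero q}} → ℤ → ℚ
q ^ℤ (+ k)     = q ^ℕ k
q ^ℤ -[1+ k ]  = (1/ q) ^ℕ suc k

-- natural division; only used with nonzero divisor (then it is ordinary _/_)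
_div_ : ℕ → ℕ → ℕ
m div zero  = 0
m div suc k = m / suc k

lcmF : ∀ {p} → (Fin p → ℕ) → ℕ
lcmF {zero}  f = 1
lcmF {suc p} f = lcm (f zero) (lcmF (λ i → f (suc i)))

sumℤ : ∀ {p} → (Fin p → ℤ) → ℤ
sumℤ {zero}  f = + 0
sumℤ {suc p} f = f zero ℤ.+ sumℤ (λ i → f (suc i))

prodℚ : ∀ {p} → (Fin p → ℚ) → ℚ
prodℚ {zero}  f = 1ℚ
prodℚ {suc p} f = f zero * prodℚ (λ i → f (suc i))

Re : ℕ → ℚ → Set
Re (suc zero) w = ⊤
Re m w = ∃[ y ] (Positive y × y ^ℕ m ≡ w)

-- Put eⱼ = cⱼ·(n/nⱼ), so that Σ eⱼ = 1 and β = ∏ tⱼ^eⱼ. If every x·tᵢ is an nᵢ-th power,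
-- then x·β = ∏ (x·tⱼ)^eⱼ is an n-th power (nⱼ·(n/nⱼ) = n) and tᵢ/tⱼ = (x·tᵢ)/(x·tⱼ) is a
-- dᵢⱼ-th power. Conversely x·tᵢ = x·β · ∏ⱼ (tᵢ/tⱼ)^eⱼ: here x·β is an nᵢ-th power because
-- nᵢ ∣ n, and (tᵢ/tⱼ)^eⱼ is a dᵢⱼ·(n/nⱼ)-th power, hence an nᵢ-th power, because lcm(nᵢ,nⱼ) ∣ n
-- and gcd·lcm = nᵢ·nⱼ give nᵢ ∣ dᵢⱼ·(n/nⱼ).
module Submission where

open import Defs
open import Algebra.Bundles using (CommutativeMonoid)
open import Data.Fin using (Fin; zero; suc; _≟_)
open import Data.Integer as ℤ using (ℤ; +_; -[1+_])
import Data.Integer.Properties as ℤ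
open import Data.Nat as ℕ using (ℕ; zero; suc; _<_; _≤_)
import Data.Nat.Properties as ℕ
open import Data.Nat.Divisibility using (_∣_; divides; _∣0; ∣-trans; *-monoʳ-∣; m*n∣o⇒m∣o/n)
open import Data.Nat.DivMod using (m*[n/m]≡n; *-/-assoc)
open import Data.Nat.GCD using (gcd; gcd[m,n]∣m; gcd[m,n]∣n)
open import Data.Nat.LCM using (m∣lcm[m,n]; n∣lcm[m,n]; lcm-least; gcd*lcm)
open import Data.Product using (_×_; _,_)
open import Data.Rational using (ℚ; 1ℚ; 1/_; NonZero; Positive; _*_; _÷_)
open import Data.Rational.Properties
  using (*-assoc; *-identityˡ; *-identityʳ; *-inverseˡ; *-inverseʳ; *-1-commutativeMonoid;
         nonZero⇒1/nonZero; pos⇒nonZero; pos*pos⇒pos; 1/pos⇒pos)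
open import Function.Bundles using (_⇔_; mk⇔)
open import Relation.Binary.PropositionalEquality
open import Relation.Nullary using (yes; no)
open import Algebra.Properties.CommutativeSemigroup
  (CommutativeMonoid.commutativeSemigroup *-1-commutativeMonoid) using (interchange)
open ≡-Reasoning

^ℕ-distribˡ-+-* : ∀ q m n → q ^ℕ (m ℕ.+ n) ≡ q ^ℕ m * q ^ℕ n
^ℕ-distribˡ-+-* q zero    n = sym (*-identityˡ _)
^ℕ-distribˡ-+-* q (suc m) n = trans (cong (q *_) (^ℕ-distribˡ-+-* q m n)) (sym (*-assoc q _ _))

^ℕ-distribʳ-* : ∀ a b n → (a * b) ^ℕ n ≡ a ^ℕ n * b ^ℕ n
^ℕ-distribʳ-* a b zero    = sym (*-identityˡ 1ℚ)
^ℕ-distribʳ-* a b (suc n) = trans (cong ((a * b) *_) (^ℕ-distribʳ-* a b n)) (interchange a b _ _)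

^ℕ-*-assoc : ∀ q m n → (q ^ℕ m) ^ℕ n ≡ q ^ℕ (m ℕ.* n)
^ℕ-*-assoc q m zero    = cong (q ^ℕ_) (sym (ℕ.*-zeroʳ m))
^ℕ-*-assoc q m (suc n) = begin
  q ^ℕ m * (q ^ℕ m) ^ℕ n  ≡⟨ cong (q ^ℕ m *_) (^ℕ-*-assoc q m n) ⟩
  q ^ℕ m * q ^ℕ (m ℕ.* n) ≡⟨ ^ℕ-distribˡ-+-* q m (m ℕ.* n) ⟨
  q ^ℕ (m ℕ.+ m ℕ.* n)    ≡⟨ cong (q ^ℕ_) (sym (ℕ.*-suc m n)) ⟩
  q ^ℕ (m ℕ.* suc n)      ∎

^ℕ-comm : ∀ q m n → (q ^ℕ m) ^ℕ n ≡ (q ^ℕ n) ^ℕ m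
^ℕ-comm q m n = begin
  (q ^ℕ m) ^ℕ n  ≡⟨ ^ℕ-*-assoc q m n ⟩
  q ^ℕ (m ℕ.* n) ≡⟨ cong (q ^ℕ_) (ℕ.*-comm m n) ⟩
  q ^ℕ (n ℕ.* m) ≡⟨ ^ℕ-*-assoc q n m ⟨
  (q ^ℕ n) ^ℕ m  ∎

1^ℕ≡1 : ∀ n → 1ℚ ^ℕ n ≡ 1ℚ
1^ℕ≡1 zero    = refl
1^ℕ≡1 (suc n) = trans (*-identityˡ _) (1^ℕ≡1 n)

^ℕ-pos : ∀ q .{{_ : Positive q}} n → Positive (q ^ℕ n)
^ℕ-pos q zero    = _
^ℕ-pos q (suc n) = pos*pos⇒pos q (q ^ℕ n) {{^ℕ-pos q n}}

1/-unique : ∀ a b .{{_ : NonZero a}} → a * b ≡ 1ℚ → b ≡ 1/ a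
1/-unique a b ab≡1 = begin
  b              ≡⟨ *-identityˡ b ⟨
  1ℚ * b         ≡⟨ cong (_* b) (*-inverseˡ a) ⟨
  (1/ a * a) * b ≡⟨ *-assoc (1/ a) a b ⟩
  1/ a * (a * b) ≡⟨ cong (1/ a *_) ab≡1 ⟩
  1/ a * 1ℚ      ≡⟨ *-identityʳ _ ⟩
  1/ a           ∎

1/-distrib-* : ∀ a b .{{_ : NonZero a}} .{{_ : NonZero b}} .{{_ : NonZero (a * b)}} →
               1/ (a * b) ≡ 1/ a * 1/ b
1/-distrib-* a b = sym (1/-unique (a * b) (1/ a * 1/ b) (begin
  (a * b) * (1/ a * 1/ b) ≡⟨ interchange a b (1/ a) (1/ b) ⟩
  (a * 1/ a) * (b * 1/ b) ≡⟨ cong₂ _*_ (*-inverseʳ a) (*-inverseʳ b) ⟩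
  1ℚ * 1ℚ                 ≡⟨ *-identityˡ 1ℚ ⟩
  1ℚ                      ∎))

1/-distrib-^ℕ : ∀ a n .{{_ : NonZero a}} .{{_ : NonZero (a ^ℕ n)}} → 1/ (a ^ℕ n) ≡ (1/ a) ^ℕ n
1/-distrib-^ℕ a n = sym (1/-unique (a ^ℕ n) ((1/ a) ^ℕ n) (begin
  a ^ℕ n * (1/ a) ^ℕ n ≡⟨ ^ℕ-distribʳ-* a (1/ a) n ⟨
  (a * 1/ a) ^ℕ n      ≡⟨ cong (_^ℕ n) (*-inverseʳ a) ⟩
  1ℚ ^ℕ n              ≡⟨ 1^ℕ≡1 n ⟩
  1ℚ                   ∎))

^ℤ-congˡ : ∀ {a b} e → a ≡ b → .{{_ : NonZero a}} .{{_ : NonZero b}} → a ^ℤ e ≡ b ^ℤ e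
^ℤ-congˡ e refl = refl

^ℤ-identityʳ : ∀ q .{{_ : NonZero q}} → q ^ℤ ℤ.1ℤ ≡ q
^ℤ-identityʳ q = *-identityʳ q

^ℤ-suc : ∀ q .{{_ : NonZero q}} a → q ^ℤ (ℤ.1ℤ ℤ.+ a) ≡ q * q ^ℤ a
^ℤ-suc q (+ k)        = refl
^ℤ-suc q -[1+ zero ]  = sym (trans (cong (q *_) (*-identityʳ _)) (*-inverseʳ q))
^ℤ-suc q -[1+ suc k ] = sym (begin
  q * (1/ q * (1/ q) ^ℕ suc k) ≡⟨ *-assoc q _ _ ⟨
  (q * 1/ q) * (1/ q) ^ℕ suc k ≡⟨ cong (_* (1/ q) ^ℕ suc k) (*-inverseʳ q) ⟩
  1ℚ * (1/ q) ^ℕ suc k         ≡⟨ *-identityˡ _ ⟩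
  (1/ q) ^ℕ suc k              ∎)

^ℤ-pred : ∀ q .{{_ : NonZero q}} a → q ^ℤ (ℤ.-1ℤ ℤ.+ a) ≡ 1/ q * q ^ℤ a
^ℤ-pred q a = begin
  q ^ℤ (ℤ.-1ℤ ℤ.+ a)                   ≡⟨ *-identityˡ _ ⟨
  1ℚ * q ^ℤ (ℤ.-1ℤ ℤ.+ a)              ≡⟨ cong (_* q ^ℤ (ℤ.-1ℤ ℤ.+ a)) (*-inverseˡ q) ⟨
  (1/ q * q) * q ^ℤ (ℤ.-1ℤ ℤ.+ a)      ≡⟨ *-assoc (1/ q) q _ ⟩
  1/ q * (q * q ^ℤ (ℤ.-1ℤ ℤ.+ a))      ≡⟨ cong (1/ q *_) (^ℤ-suc q (ℤ.-1ℤ ℤ.+ a)) ⟨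
  1/ q * q ^ℤ (ℤ.1ℤ ℤ.+ (ℤ.-1ℤ ℤ.+ a)) ≡⟨ cong (λ b → 1/ q * q ^ℤ b) (ℤ.+-assoc ℤ.1ℤ ℤ.-1ℤ a) ⟨
  1/ q * q ^ℤ (ℤ.0ℤ ℤ.+ a)             ≡⟨ cong (λ b → 1/ q * q ^ℤ b) (ℤ.+-identityˡ a) ⟩
  1/ q * q ^ℤ a                        ∎

^ℤ-distribˡ-+-* : ∀ q .{{_ : NonZero q}} a b → q ^ℤ (a ℤ.+ b) ≡ q ^ℤ a * q ^ℤ b
^ℤ-distribˡ-+-* q (+ zero) b = trans (cong (q ^ℤ_) (ℤ.+-identityˡ b)) (sym (*-identityˡ _))
^ℤ-distribˡ-+-* q (+ suc k) b = begin
  q ^ℤ (+ suc k ℤ.+ b)         ≡⟨ cong (q ^ℤ_) (ℤ.+-assoc ℤ.1ℤ (+ k) b) ⟩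
  q ^ℤ (ℤ.1ℤ ℤ.+ (+ k ℤ.+ b)) ≡⟨ ^ℤ-suc q (+ k ℤ.+ b) ⟩
  q * q ^ℤ (+ k ℤ.+ b)         ≡⟨ cong (q *_) (^ℤ-distribˡ-+-* q (+ k) b) ⟩
  q * (q ^ℕ k * q ^ℤ b)        ≡⟨ *-assoc q _ _ ⟨
  q ^ℤ (+ suc k) * q ^ℤ b      ∎
^ℤ-distribˡ-+-* q -[1+ zero ] b =
  trans (^ℤ-pred q b) (cong (_* q ^ℤ b) (sym (*-identityʳ (1/ q))))
^ℤ-distribˡ-+-* q -[1+ suc k ] b = begin
  q ^ℤ (-[1+ suc k ] ℤ.+ b)          ≡⟨ cong (q ^ℤ_) (ℤ.+-assoc ℤ.-1ℤ -[1+ k ] b) ⟩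
  q ^ℤ (ℤ.-1ℤ ℤ.+ (-[1+ k ] ℤ.+ b)) ≡⟨ ^ℤ-pred q (-[1+ k ] ℤ.+ b) ⟩
  1/ q * q ^ℤ (-[1+ k ] ℤ.+ b)       ≡⟨ cong (1/ q *_) (^ℤ-distribˡ-+-* q -[1+ k ] b) ⟩
  1/ q * (q ^ℤ -[1+ k ] * q ^ℤ b)    ≡⟨ *-assoc (1/ q) _ _ ⟨
  q ^ℤ -[1+ suc k ] * q ^ℤ b         ∎

^ℤ-^ℕ-assoc : ∀ q .{{_ : NonZero q}} a m → (q ^ℤ a) ^ℕ m ≡ q ^ℤ (a ℤ.* + m)
^ℤ-^ℕ-assoc q a zero    = cong (q ^ℤ_) (sym (ℤ.*-zeroʳ a))
^ℤ-^ℕ-assoc q a (suc m) = begin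
  q ^ℤ a * (q ^ℤ a) ^ℕ m      ≡⟨ cong (q ^ℤ a *_) (^ℤ-^ℕ-assoc q a m) ⟩
  q ^ℤ a * q ^ℤ (a ℤ.* + m)  ≡⟨ ^ℤ-distribˡ-+-* q a (a ℤ.* + m) ⟨
  q ^ℤ (a ℤ.+ a ℤ.* + m)     ≡⟨ cong (λ b → q ^ℤ (b ℤ.+ a ℤ.* + m)) (ℤ.*-identityʳ a) ⟨
  q ^ℤ (a ℤ.* ℤ.1ℤ ℤ.+ a ℤ.* + m) ≡⟨ cong (q ^ℤ_) (ℤ.*-distribˡ-+ a ℤ.1ℤ (+ m)) ⟨
  q ^ℤ (a ℤ.* + suc m)       ∎

^ℕ-^ℤ-comm : ∀ q m e .{{_ : NonZero q}} .{{_ : NonZero (q ^ℕ m)}} → (q ^ℕ m) ^ℤ e ≡ (q ^ℤ e) ^ℕ m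
^ℕ-^ℤ-comm q m (+ k)     = ^ℕ-comm q m k
^ℕ-^ℤ-comm q m -[1+ k ] = trans (cong (_^ℕ suc k) (1/-distrib-^ℕ q m)) (^ℕ-comm (1/ q) m (suc k))

^ℤ-distribʳ-* : ∀ a b e .{{_ : NonZero a}} .{{_ : NonZero b}} .{{_ : NonZero (a * b)}} →
                (a * b) ^ℤ e ≡ a ^ℤ e * b ^ℤ e
^ℤ-distribʳ-* a b (+ k)     = ^ℕ-distribʳ-* a b k
^ℤ-distribʳ-* a b -[1+ k ] = trans (cong (_^ℕ suc k) (1/-distrib-* a b)) (^ℕ-distribʳ-* (1/ a) (1/ b) (suc k))

1^ℤ≡1 : ∀ e → 1ℚ ^ℤ e ≡ 1ℚ
1^ℤ≡1 (+ k)     = 1^ℕ≡1 k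
1^ℤ≡1 -[1+ k ] = 1^ℕ≡1 (suc k)

^ℤ-pos : ∀ q .{{_ : Positive q}} e → Positive (_^ℤ_ q {{pos⇒nonZero q}} e)
^ℤ-pos q (+ k)     = ^ℕ-pos q k
^ℤ-pos q -[1+ k ] = ^ℕ-pos (1/_ q {{pos⇒nonZero q}}) {{1/pos⇒pos q}} (suc k)

prodℚ-cong : ∀ {p} {f g : Fin p → ℚ} → (∀ i → f i ≡ g i) → prodℚ f ≡ prodℚ g
prodℚ-cong {zero}  f≗g = refl
prodℚ-cong {suc p} f≗g = cong₂ _*_ (f≗g zero) (prodℚ-cong (λ i → f≗g (suc i)))

prodℚ-distrib-* : ∀ {p} (f g : Fin p → ℚ) → prodℚ (λ i → f i * g i) ≡ prodℚ f * prodℚ g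
prodℚ-distrib-* {zero}  f g = sym (*-identityˡ 1ℚ)
prodℚ-distrib-* {suc p} f g = trans
  (cong (f zero * g zero *_) (prodℚ-distrib-* (λ i → f (suc i)) (λ i → g (suc i))))
  (interchange (f zero) (g zero) _ _)

prodℚ-1 : ∀ p → prodℚ {p} (λ _ → 1ℚ) ≡ 1ℚ
prodℚ-1 zero    = refl
prodℚ-1 (suc p) = trans (*-identityˡ _) (prodℚ-1 p)

prodℚ-pos : ∀ {p} (f : Fin p → ℚ) → (∀ i → Positive (f i)) → Positive (prodℚ f)
prodℚ-pos {zero}  f f>0 = _
prodℚ-pos {suc p} f f>0 =
  pos*pos⇒pos (f zero) {{f>0 zero}} _ {{prodℚ-pos (λ i → f (suc i)) (λ i → f>0 (suc i))}}

^ℤ-sumℤ : ∀ q .{{_ : NonZero q}} {p} (e : Fin p → ℤ) → q ^ℤ sumℤ e ≡ prodℚ (λ i → q ^ℤ e i)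
^ℤ-sumℤ q {zero}  e = refl
^ℤ-sumℤ q {suc p} e =
  trans (^ℤ-distribˡ-+-* q (e zero) _) (cong (q ^ℤ e zero *_) (^ℤ-sumℤ q (λ i → e (suc i))))

module _ {p} (e : Fin p → ℤ) where

  prodℚ-^ℤ-affine : ∀ a (b : Fin p → ℚ) .{{_ : NonZero a}} .{{_ : ∀ {j} → NonZero (b j)}}
                    .{{_ : ∀ {j} → NonZero (a * b j)}} → sumℤ e ≡ + 1 →
                    a * prodℚ (λ j → b j ^ℤ e j) ≡ prodℚ (λ j → (a * b j) ^ℤ e j)
  prodℚ-^ℤ-affine a b Σe≡1 = begin
    a * β                           ≡⟨ cong (_* β) (^ℤ-identityʳ a) ⟨
    a ^ℤ (+ 1) * β                  ≡⟨ cong (λ k → a ^ℤ k * β) Σe≡1 ⟨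
    a ^ℤ sumℤ e * β                 ≡⟨ cong (_* β) (^ℤ-sumℤ a e) ⟩
    prodℚ (λ j → a ^ℤ e j) * β      ≡⟨ prodℚ-distrib-* {p} _ _ ⟨
    prodℚ (λ j → a ^ℤ e j * b j ^ℤ e j) ≡⟨ prodℚ-cong {p} (λ j → ^ℤ-distribʳ-* a (b j) (e j)) ⟨
    prodℚ (λ j → (a * b j) ^ℤ e j)  ∎
    where
    β : ℚ
    β = prodℚ (λ j → b j ^ℤ e j)

  prodℚ-^ℤ-inverse : ∀ (b b′ : Fin p → ℚ) .{{_ : ∀ {j} → NonZero (b j)}}
                     .{{_ : ∀ {j} → NonZero (b′ j)}} → (∀ j → b j * b′ j ≡ 1ℚ) →
                     prodℚ (λ j → b j ^ℤ e j) * prodℚ (λ j → b′ j ^ℤ e j) ≡ 1ℚ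
  prodℚ-^ℤ-inverse b b′ bb′≡1 = begin
    prodℚ (λ j → b j ^ℤ e j) * prodℚ (λ j → b′ j ^ℤ e j) ≡⟨ prodℚ-distrib-* {p} _ _ ⟨
    prodℚ (λ j → b j ^ℤ e j * b′ j ^ℤ e j)              ≡⟨ prodℚ-cong {p} b^e*b′^e≡1 ⟩
    prodℚ {p} (λ _ → 1ℚ)                               ≡⟨ prodℚ-1 p ⟩
    1ℚ                                                 ∎
    where
    instance
      bb′≢0 : ∀ {j} → NonZero (b j * b′ j)
      bb′≢0 {j} = subst NonZero (sym (bb′≡1 j)) _
    b^e*b′^e≡1 : ∀ j → b j ^ℤ e j * b′ j ^ℤ e j ≡ 1ℚ
    b^e*b′^e≡1 j = begin
      b j ^ℤ e j * b′ j ^ℤ e j ≡⟨ ^ℤ-distribʳ-* (b j) (b′ j) (e j) ⟨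
      (b j * b′ j) ^ℤ e j     ≡⟨ ^ℤ-congˡ (e j) (bb′≡1 j) ⟩
      1ℚ ^ℤ e j                ≡⟨ 1^ℤ≡1 (e j) ⟩
      1ℚ                       ∎

  *-prodℚ-^ℤ-÷ : ∀ x (t : Fin p → ℚ) i .{{_ : ∀ {j} → NonZero (t j)}}
                 .{{_ : ∀ {j} → NonZero (t i ÷ t j)}} → sumℤ e ≡ + 1 →
                 (x * prodℚ (λ j → t j ^ℤ e j)) * prodℚ (λ j → (t i ÷ t j) ^ℤ e j) ≡ x * t i
  *-prodℚ-^ℤ-÷ x t i Σe≡1 = begin
    (x * β) * prodℚ (λ j → (t i ÷ t j) ^ℤ e j) ≡⟨ cong ((x * β) *_) (prodℚ-^ℤ-affine (t i) 1/t Σe≡1) ⟨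
    (x * β) * (t i * β⁻¹)                      ≡⟨ interchange x β (t i) β⁻¹ ⟩
    (x * t i) * (β * β⁻¹)                      ≡⟨ cong ((x * t i) *_) β*β⁻¹≡1 ⟩
    (x * t i) * 1ℚ                             ≡⟨ *-identityʳ _ ⟩
    x * t i                                    ∎
    where
    1/t : Fin p → ℚ
    1/t j = 1/ t j
    instance
      1/t≢0 : ∀ {j} → NonZero (1/t j)
      1/t≢0 {j} = nonZero⇒1/nonZero (t j)
    β β⁻¹ : ℚ
    β = prodℚ (λ j → t j ^ℤ e j)
    β⁻¹ = prodℚ (λ j → 1/t j ^ℤ e j)
    β*β⁻¹≡1 : β * β⁻¹ ≡ 1ℚ
    β*β⁻¹≡1 = prodℚ-^ℤ-inverse t 1/t (λ j → *-inverseʳ (t j))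

*-cancelˡ-÷ : ∀ x a b .{{_ : NonZero x}} .{{_ : NonZero b}} .{{_ : NonZero (x * b)}} →
              (x * a) ÷ (x * b) ≡ a ÷ b
*-cancelˡ-÷ x a b = begin
  (x * a) * 1/ (x * b)    ≡⟨ cong ((x * a) *_) (1/-distrib-* x b) ⟩
  (x * a) * (1/ x * 1/ b) ≡⟨ interchange x a (1/ x) (1/ b) ⟩
  (x * 1/ x) * (a * 1/ b) ≡⟨ cong (_* (a * 1/ b)) (*-inverseʳ x) ⟩
  1ℚ * (a * 1/ b)         ≡⟨ *-identityˡ _ ⟩
  a * 1/ b                ∎

-- ℜₘ without the convention for m = 1; a record, so that m and w can be read off the type.
record IsPower (m : ℕ) (w : ℚ) : Set where
  constructor root
  field
    y     : ℚ
    y>0   : Positive y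
    yᵐ≡w : y ^ℕ m ≡ w

Re⇒IsPower : ∀ m {w} → Positive w → Re m w → IsPower m w
Re⇒IsPower zero          w>0 (y , y>0 , yᵐ≡w) = root y y>0 yᵐ≡w
Re⇒IsPower (suc zero) {w} w>0 _                = root w w>0 (*-identityʳ _)
Re⇒IsPower (suc (suc m)) w>0 (y , y>0 , yᵐ≡w) = root y y>0 yᵐ≡w

IsPower⇒Re : ∀ m {w} → IsPower m w → Re m w
IsPower⇒Re zero          (root y y>0 yᵐ≡w) = y , y>0 , yᵐ≡w
IsPower⇒Re (suc zero)    _                 = _
IsPower⇒Re (suc (suc m)) (root y y>0 yᵐ≡w) = y , y>0 , yᵐ≡w

IsPower-1 : ∀ m → IsPower m 1ℚ
IsPower-1 m = root 1ℚ _ (1^ℕ≡1 m)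

IsPower-* : ∀ {m a b} → IsPower m a → IsPower m b → IsPower m (a * b)
IsPower-* {m} (root y y>0 refl) (root z z>0 refl) =
  root (y * z) (pos*pos⇒pos y {{y>0}} z {{z>0}}) (^ℕ-distribʳ-* y z m)

IsPower-prodℚ : ∀ {m p} (f : Fin p → ℚ) → (∀ i → IsPower m (f i)) → IsPower m (prodℚ f)
IsPower-prodℚ {m} {zero} f fᵢ = IsPower-1 m
IsPower-prodℚ {p = suc p} f fᵢ =
  IsPower-* (fᵢ zero) (IsPower-prodℚ (λ i → f (suc i)) (λ i → fᵢ (suc i)))

IsPower-∣ : ∀ {m m′ a} → m ∣ m′ → IsPower m′ a → IsPower m a
IsPower-∣ {m} (divides k refl) (root y y>0 refl) =
  root (y ^ℕ k) (^ℕ-pos y {{y>0}} k) (^ℕ-*-assoc y k m)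

IsPower-1/ : ∀ {m a} .{{_ : NonZero a}} → IsPower m a → IsPower m (1/ a)
IsPower-1/ {m} (root y y>0 refl) = root (1/ y) (1/pos⇒pos y {{y>0}}) (sym (1/-distrib-^ℕ y m))
  where
  instance
    y≢0 : NonZero y
    y≢0 = pos⇒nonZero y {{y>0}}

IsPower-^ℤ : ∀ {m a} .{{_ : NonZero a}} c → IsPower m a → IsPower m (a ^ℤ c)
IsPower-^ℤ {m} c (root y y>0 refl) = root (y ^ℤ c) (^ℤ-pos y {{y>0}} c) (sym (^ℕ-^ℤ-comm y m c))
  where
  instance
    y≢0 : NonZero y
    y≢0 = pos⇒nonZero y {{y>0}}

IsPower-^ℕ : ∀ {m a} u → IsPower m a → IsPower (m ℕ.* u) (a ^ℕ u)
IsPower-^ℕ {m} u (root y y>0 refl) = root y y>0 (sym (^ℕ-*-assoc y m u))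

IsPower-^ℤ-* : ∀ {m a} .{{_ : NonZero a}} c u → IsPower m a → IsPower (m ℕ.* u) (a ^ℤ (c ℤ.* + u))
IsPower-^ℤ-* {a = a} c u aᵐ =
  subst (IsPower _) (^ℤ-^ℕ-assoc a c u) (IsPower-^ℕ u (IsPower-^ℤ c aᵐ))

∣lcmF : ∀ {p} (f : Fin p → ℕ) i → f i ∣ lcmF f
∣lcmF f zero    = m∣lcm[m,n] (f zero) _
∣lcmF f (suc i) = ∣-trans (∣lcmF (λ k → f (suc k)) i) (n∣lcm[m,n] (f zero) _)

div-exact : ∀ {m n} → m ∣ n → m ℕ.* (n div m) ≡ n
div-exact {zero}  (divides q refl) = sym (ℕ.*-zeroʳ q)
div-exact {suc m} m∣n              = m*[n/m]≡n m∣n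

m∣gcd[m,n]*[o/n] : ∀ m n {o} → m ∣ o → n ∣ o → m ∣ gcd m n ℕ.* (o div n)
m∣gcd[m,n]*[o/n] m zero    m∣o n∣o = subst (m ∣_) (sym (ℕ.*-zeroʳ (gcd m 0))) (m ∣0)
m∣gcd[m,n]*[o/n] m n@(suc _) {o} m∣o n∣o =
  subst (m ∣_) (*-/-assoc g n∣o) (m*n∣o⇒m∣o/n m n mn∣go)
  where
  g = gcd m n
  mn∣go : m ℕ.* n ∣ g ℕ.* o
  mn∣go = subst (_∣ g ℕ.* o) (gcd*lcm m n) (*-monoʳ-∣ g (lcm-least m∣o n∣o))

module PowerCriterion {p} (ns : Fin p → ℕ) (ts : Fin p → ℚ) (ts>0 : ∀ i → Positive (ts i))
                      (x : ℚ) (x>0 : Positive x) (c : Fin p → ℤ) where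

  n : ℕ
  n = lcmF ns

  e : Fin p → ℤ
  e j = c j ℤ.* + (n div ns j)

  instance
    ts≢0 : ∀ {j} → NonZero (ts j)
    ts≢0 {j} = pos⇒nonZero (ts j) {{ts>0 j}}
    x≢0 : NonZero x
    x≢0 = pos⇒nonZero x {{x>0}}

  xts>0 : ∀ j → Positive (x * ts j)
  xts>0 j = pos*pos⇒pos x {{x>0}} (ts j) {{ts>0 j}}

  ts÷ts>0 : ∀ i j → Positive (ts i ÷ ts j)
  ts÷ts>0 i j = pos*pos⇒pos (ts i) {{ts>0 i}} (1/ ts j) {{1/pos⇒pos (ts j) {{ts>0 j}}}}

  instance
    xts≢0 : ∀ {j} → NonZero (x * ts j)
    xts≢0 {j} = pos⇒nonZero (x * ts j) {{xts>0 j}}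
    ts÷ts≢0 : ∀ {i j} → NonZero (ts i ÷ ts j)
    ts÷ts≢0 {i} {j} = pos⇒nonZero (ts i ÷ ts j) {{ts÷ts>0 i j}}

  β : ℚ
  β = prodℚ (λ j → ts j ^ℤ e j)

  xβ>0 : Positive (x * β)
  xβ>0 = pos*pos⇒pos x {{x>0}} β {{prodℚ-pos _ (λ j → ^ℤ-pos (ts j) {{ts>0 j}} (e j))}}

  powers⇒xβ-power : sumℤ e ≡ + 1 → (∀ i → IsPower (ns i) (x * ts i)) → IsPower n (x * β)
  powers⇒xβ-power Σe≡1 xtᵢ-power = subst (IsPower n) (sym (prodℚ-^ℤ-affine e x ts Σe≡1))
    (IsPower-prodℚ _ λ j → subst (λ m → IsPower m ((x * ts j) ^ℤ e j)) (div-exact (∣lcmF ns j))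
      (IsPower-^ℤ-* (c j) (n div ns j) (xtᵢ-power j)))

  powers⇒quotient-powers : (∀ i → IsPower (ns i) (x * ts i)) →
                           ∀ i j → IsPower (gcd (ns i) (ns j)) (ts i ÷ ts j)
  powers⇒quotient-powers xtᵢ-power i j = subst (IsPower _) (*-cancelˡ-÷ x (ts i) (ts j)) (IsPower-*
    (IsPower-∣ (gcd[m,n]∣m (ns i) (ns j)) (xtᵢ-power i))
    (IsPower-1/ (IsPower-∣ (gcd[m,n]∣n (ns i) (ns j)) (xtᵢ-power j))))

  xβ-power∧quotient-powers⇒powers : sumℤ e ≡ + 1 → IsPower n (x * β) →
    (∀ i j → i ≢ j → IsPower (gcd (ns i) (ns j)) (ts i ÷ ts j)) → ∀ i → IsPower (ns i) (x * ts i)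
  xβ-power∧quotient-powers⇒powers Σe≡1 xβ-power quotient-power i =
    subst (IsPower (ns i)) (*-prodℚ-^ℤ-÷ e x ts i Σe≡1)
      (IsPower-* (IsPower-∣ (∣lcmF ns i) xβ-power) (IsPower-prodℚ _ quotientᵉ-power))
    where
    quotientᵉ-power : ∀ j → IsPower (ns i) ((ts i ÷ ts j) ^ℤ e j)
    quotientᵉ-power j with i ≟ j
    ... | yes refl = IsPower-^ℤ (e j) (subst (IsPower (ns i)) (sym (*-inverseʳ (ts i))) (IsPower-1 (ns i)))
    ... | no i≢j   = IsPower-∣ (m∣gcd[m,n]*[o/n] (ns i) (ns j) (∣lcmF ns i) (∣lcmF ns j))
                               (IsPower-^ℤ-* (c j) (n div ns j) (quotient-power i j i≢j))

lemma2 : (p : ℕ) → 1 ≤ p →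
    (ns : Fin p → ℕ) → (∀ i → 1 < ns i) →
    (ts : Fin p → ℚ) → (tpos : ∀ i → Positive (ts i)) →
    (x : ℚ) → Positive x →
    (c : Fin p → ℤ) →
    sumℤ (λ i → c i ℤ.* (+ (lcmF ns div ns i))) ≡ + 1 →
    ((∀ i → Re (ns i) (x * ts i))
      ⇔
     (Re (lcmF ns)
         (x * prodℚ (λ i → _^ℤ_ (ts i) {{pos⇒nonZero (ts i) {{tpos i}}}} (c i ℤ.* (+ (lcmF ns div ns i)))))
      × (∀ i j → i ≢ j → Re (gcd (ns i) (ns j)) (_÷_ (ts i) (ts j) {{pos⇒nonZero (ts j) {{tpos j}}}}))))
lemma2 p _ ns _ ts ts>0 x x>0 c Σe≡1 = mk⇔
  (λ xtᵢ∈ℜ → let xtᵢ-power = λ i → Re⇒IsPower (ns i) (xts>0 i) (xtᵢ∈ℜ i) in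
    IsPower⇒Re n (powers⇒xβ-power Σe≡1 xtᵢ-power) ,
    λ i j _ → IsPower⇒Re _ (powers⇒quotient-powers xtᵢ-power i j))
  (λ (xβ∈ℜ , tᵢ÷tⱼ∈ℜ) i → IsPower⇒Re (ns i) (xβ-power∧quotient-powers⇒powers Σe≡1
    (Re⇒IsPower n xβ>0 xβ∈ℜ)
    (λ j k j≢k → Re⇒IsPower _ (ts÷ts>0 j k) (tᵢ÷tⱼ∈ℜ j k j≢k)) i))
  where open PowerCriterion ns ts ts>0 x x>0 c
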